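{- For all positive integers $m,n$, the complete bipartite graph $K_{m,n}$ is a proper max-point-tolerance graph.
   Context: $G=(V,E)$ (finite, simple, undirected) is a max-point-tolerance graph (MPTG) if each vertex $u$ can be assigned a pair $(I_u,p_u)$, with $I_u$ a closed bounded real interval and $p_u\in I_u$, such that for distinct $u,v$, $uv\in E$ iff $\{p_u,p_v\}\subseteq I_u\cap I_v$. It is a proper MPTG if it has such a representation in which no interval properly contains another. -}

module Defs where

open import Data.Nat using (ℕ)
open import Data.Fin using (Fin)
open import Data.Sum using (_⊎_; inj₁; inj₂)
open import Data.Product using (_×_; Σ; _,_)
open import Data.Empty using (⊥)
open import Data.Unit using (⊤)
open import Data.Rational using (ℚ; _≤_)
open import Relation.Binary.PropositionalEquality using (_≡_)
open import Relation.Nullary using (¬_)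
open import Function.Bundles using (_⇔_)

record IntervalPoint : Set where
  field
    left  : ℚ
    right : ℚ
    point : ℚ
    left≤point  : left ≤ point
    point≤right : point ≤ right

open IntervalPoint public

_∈I_ : ℚ → IntervalPoint → Set
x ∈I a = (left a ≤ x) × (x ≤ right a)

Tolerant : IntervalPoint → IntervalPoint → Set
Tolerant a b = (point a ∈I a) × (point a ∈I b) × (point b ∈I a) × (point b ∈I b)

IsMPTRep : (V : Set) → (V → V → Set) → (V → IntervalPoint) → Set
IsMPTRep V E rep = ∀ (u v : V) → ¬ (u ≡ v) → (E u v ⇔ Tolerant (rep u) (rep v))

_⊆I_ : IntervalPoint → IntervalPoint → Set
a ⊆I b = (left b ≤ left a) × (right a ≤ right b)

-- I_a properly contained in I_b (closed bounded nonempty intervals are equal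
-- as sets iff their endpoints agree)
_⊂I_ : IntervalPoint → IntervalPoint → Set
a ⊂I b = (a ⊆I b) × ¬ ((left a ≡ left b) × (right a ≡ right b))

IsProperRep : (V : Set) → (V → IntervalPoint) → Set
IsProperRep V rep = ∀ (u v : V) → ¬ (rep u ⊂I rep v)

IsMPTG : (V : Set) → (V → V → Set) → Set
IsMPTG V E = Σ (V → IntervalPoint) λ rep → IsMPTRep V E rep

IsProperMPTG : (V : Set) → (V → V → Set) → Set
IsProperMPTG V E = Σ (V → IntervalPoint) λ rep → IsMPTRep V E rep × IsProperRep V rep

KBip-V : ℕ → ℕ → Set
KBip-V m n = Fin m ⊎ Fin n

KBip-E : (m n : ℕ) → KBip-V m n → KBip-V m n → Set
KBip-E m n (inj₁ _) (inj₁ _) = ⊥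
KBip-E m n (inj₁ _) (inj₂ _) = ⊤
KBip-E m n (inj₂ _) (inj₁ _) = ⊤
KBip-E m n (inj₂ _) (inj₂ _) = ⊥

-- Put S = m + n. The vertex i of the first side gets the interval [i , i + S]
-- with its point at the right end, the vertex j of the second side gets
-- [m + j , m + j + S] with its point at the left end. All intervals have
-- length S, so none properly contains another. Two intervals pointed at their
-- right ends are tolerant only if each point lies weakly left of the other,
-- i.e. they coincide, and likewise for left ends; so each side is independent.
-- Across the sides, i ≤ m + j ≤ i + S puts each point inside the other interval.
module Submission where

open import Defs
open import Data.Nat using (ℕ; _≤_; _+_)
open import Data.Nat.Properties
  using (≤-refl; ≤-trans; ≤-antisym; <⇒≤; m≤m+n; m≤n+m; +-monoˡ-≤; +-monoʳ-≤; +-cancelʳ-≤; +-cancelˡ-≡)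
open import Data.Integer as ℤ using (+_; +≤+)
open import Data.Integer.Properties using (*-identityʳ; drop‿+≤+)
open import Data.Rational as ℚ using (ℚ; *≤*)
open import Data.Rational.Literals using (fromℤ)
open import Data.Fin using (toℕ)
open import Data.Fin.Properties using (toℕ<n; toℕ-injective)
open import Data.Sum using (inj₁; inj₂)
open import Data.Product using (_,_)
open import Data.Unit using (tt)
open import Relation.Binary.PropositionalEquality using (_≡_; sym; cong; subst₂)
open import Function.Bundles using (mk⇔)

fromℕ : ℕ → ℚ
fromℕ n = fromℤ (+ n)

fromℕ-mono-≤ : ∀ {a b} → a ≤ b → fromℕ a ℚ.≤ fromℕ b
fromℕ-mono-≤ {a} {b} a≤b =
  *≤* (subst₂ ℤ._≤_ (sym (*-identityʳ (+ a))) (sym (*-identityʳ (+ b))) (+≤+ a≤b))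

fromℕ-cancel-≤ : ∀ {a b} → fromℕ a ℚ.≤ fromℕ b → a ≤ b
fromℕ-cancel-≤ {a} {b} (*≤* a≤b) =
  drop‿+≤+ (subst₂ ℤ._≤_ (*-identityʳ (+ a)) (*-identityʳ (+ b)) a≤b)

Tolerant-sym : ∀ {a b} → Tolerant a b → Tolerant b a
Tolerant-sym (pa∈a , pa∈b , pb∈a , pb∈b) = pb∈b , pb∈a , pa∈b , pa∈a

data End : Set where
  leftEnd rightEnd : End

endPoint : End → ℕ → ℕ → ℕ
endPoint leftEnd  ℓ s = ℓ
endPoint rightEnd ℓ s = ℓ + s

start≤endPoint : ∀ e ℓ s → ℓ ≤ endPoint e ℓ s
start≤endPoint leftEnd  ℓ s = ≤-refl
start≤endPoint rightEnd ℓ s = m≤m+n ℓ s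

endPoint≤finish : ∀ e ℓ s → endPoint e ℓ s ≤ ℓ + s
endPoint≤finish leftEnd  ℓ s = m≤m+n ℓ s
endPoint≤finish rightEnd ℓ s = ≤-refl

window : End → (ℓ s : ℕ) → IntervalPoint
window e ℓ s = record
  { left        = fromℕ ℓ
  ; right       = fromℕ (ℓ + s)
  ; point       = fromℕ (endPoint e ℓ s)
  ; left≤point  = fromℕ-mono-≤ (start≤endPoint e ℓ s)
  ; point≤right = fromℕ-mono-≤ (endPoint≤finish e ℓ s)
  }

window-⊆I⇒start≡ : ∀ {e e′ ℓ ℓ′ s} → window e ℓ s ⊆I window e′ ℓ′ s → ℓ ≡ ℓ′
window-⊆I⇒start≡ {ℓ = ℓ} {ℓ′} {s} (ℓ′≤ℓ , ℓ+s≤ℓ′+s) =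
  ≤-antisym (+-cancelʳ-≤ s ℓ ℓ′ (fromℕ-cancel-≤ ℓ+s≤ℓ′+s)) (fromℕ-cancel-≤ ℓ′≤ℓ)

windows-proper : ∀ {V : Set} (end : V → End) (start : V → ℕ) (s : ℕ) →
                 IsProperRep V (λ v → window (end v) (start v) s)
windows-proper end start s u v (⊆ , ≢) =
  ≢ (cong fromℕ ℓ≡ℓ′ , cong (λ ℓ → fromℕ (ℓ + s)) ℓ≡ℓ′)
  where
  ℓ≡ℓ′ : start u ≡ start v
  ℓ≡ℓ′ = window-⊆I⇒start≡ {end u} {end v} ⊆

window-tolerant-sameEnd⇒≡ : ∀ e {ℓ ℓ′ s} → Tolerant (window e ℓ s) (window e ℓ′ s) → ℓ ≡ ℓ′
window-tolerant-sameEnd⇒≡ leftEnd (_ , (ℓ′≤ℓ , _) , (ℓ≤ℓ′ , _) , _) =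
  ≤-antisym (fromℕ-cancel-≤ ℓ≤ℓ′) (fromℕ-cancel-≤ ℓ′≤ℓ)
window-tolerant-sameEnd⇒≡ rightEnd {ℓ} {ℓ′} {s} (_ , (_ , ℓ+s≤ℓ′+s) , (_ , ℓ′+s≤ℓ+s) , _) =
  ≤-antisym (+-cancelʳ-≤ s ℓ ℓ′ (fromℕ-cancel-≤ ℓ+s≤ℓ′+s))
            (+-cancelʳ-≤ s ℓ′ ℓ (fromℕ-cancel-≤ ℓ′+s≤ℓ+s))

window-tolerant-crossing : ∀ {ℓ ℓ′ s} → ℓ ≤ ℓ′ → ℓ′ ≤ ℓ + s →
                           Tolerant (window rightEnd ℓ s) (window leftEnd ℓ′ s)
window-tolerant-crossing {ℓ} {ℓ′} {s} ℓ≤ℓ′ ℓ′≤ℓ+s =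
    (fromℕ-mono-≤ (m≤m+n ℓ s) , fromℕ-mono-≤ ≤-refl)
  , (fromℕ-mono-≤ ℓ′≤ℓ+s , fromℕ-mono-≤ (+-monoˡ-≤ s ℓ≤ℓ′))
  , (fromℕ-mono-≤ ℓ≤ℓ′ , fromℕ-mono-≤ ℓ′≤ℓ+s)
  , (fromℕ-mono-≤ ≤-refl , fromℕ-mono-≤ (m≤m+n ℓ′ s))

module _ (m n : ℕ) where

  side : KBip-V m n → End
  side (inj₁ _) = rightEnd
  side (inj₂ _) = leftEnd

  start : KBip-V m n → ℕ
  start (inj₁ i) = toℕ i
  start (inj₂ j) = m + toℕ j

  rep : KBip-V m n → IntervalPoint
  rep v = window (side v) (start v) (m + n)

  crossing-tolerant : ∀ i j → Tolerant (rep (inj₁ i)) (rep (inj₂ j))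
  crossing-tolerant i j = window-tolerant-crossing
    (≤-trans (<⇒≤ (toℕ<n i)) (m≤m+n m (toℕ j)))
    (≤-trans (+-monoʳ-≤ m (<⇒≤ (toℕ<n j))) (m≤n+m (m + n) (toℕ i)))

  rep-isMPTRep : IsMPTRep (KBip-V m n) (KBip-E m n) rep
  rep-isMPTRep (inj₁ i) (inj₁ i′) i≢i′ = mk⇔ (λ ()) λ tol →
    i≢i′ (cong inj₁ (toℕ-injective (window-tolerant-sameEnd⇒≡ rightEnd tol)))
  rep-isMPTRep (inj₁ i) (inj₂ j) _ = mk⇔ (λ _ → crossing-tolerant i j) (λ _ → tt)
  rep-isMPTRep (inj₂ j) (inj₁ i) _ =
    mk⇔ (λ _ → Tolerant-sym {rep (inj₁ i)} {rep (inj₂ j)} (crossing-tolerant i j)) (λ _ → tt)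
  rep-isMPTRep (inj₂ j) (inj₂ j′) j≢j′ = mk⇔ (λ ()) λ tol →
    j≢j′ (cong inj₂ (toℕ-injective (+-cancelˡ-≡ m _ _ (window-tolerant-sameEnd⇒≡ leftEnd tol))))

proposition3p3 : (m n : ℕ) → 1 ≤ m → 1 ≤ n → IsProperMPTG (KBip-V m n) (KBip-E m n)
proposition3p3 m n _ _ =
  rep m n , rep-isMPTRep m n , windows-proper (side m n) (start m n) (m + n)
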